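{- Let $0<\alpha<1$ and let $G=(V,E)$ be a connected graph on $n$ nodes with minimum degree $\delta$. Then $1\le MD_{\alpha}(G)\le \left(\frac{\delta+\frac{1}{\alpha}}{\delta+1}\right)\alpha n$.
   Context: A configuration is a map $\mathcal{C}:V\to\{b,w\}$ (black/white). In $\alpha$-bootstrap percolation ($0<\alpha<1$), starting from $\mathcal{C}_0$, in each round $t\ge1$ all nodes update simultaneously: $\mathcal{C}_t(v)=b$ iff $\mathcal{C}_{t-1}(v)=b$ or the number of neighbors of $v$ that are black in $\mathcal{C}_{t-1}$ is at least $\alpha d(v)$, where $d(v)$ is the degree of $v$; otherwise $\mathcal{C}_t(v)=w$. A set $D\subseteq V$ is a dynamo if for every initial configuration in which all nodes of $D$ are black, eventually all nodes of $V$ are black. $MD_\alpha(G)$ is the minimum size of a dynamo in $\alpha$-bootstrap percolation on $G$. -}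

module Defs where

open import Data.Nat using (ℕ; zero; suc; _≤_)
open import Data.Fin using (Fin; zero; suc)
open import Data.Bool using (Bool; true; false; _∧_; _∨_; if_then_else_)
open import Data.Integer using (+_)
open import Data.Rational using (ℚ; _/_; _*_; _≤ᵇ_)
open import Data.Fin.Subset using (Subset; _∈_; ∣_∣)
open import Data.Product using (Σ; ∃; _×_)
open import Relation.Binary.PropositionalEquality using (_≡_)
open import Relation.Nullary using (¬_)

ℕtoℚ : ℕ → ℚ
ℕtoℚ k = (+ k) / 1

record Graph (n : ℕ) : Set where
  field
    adj     : Fin n → Fin n → Bool
    sym     : ∀ u v → adj u v ≡ adj v u
    irrefl  : ∀ v → adj v v ≡ false

countTrue : ∀ {n} → (Fin n → Bool) → ℕ
countTrue {zero}  f = zero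
countTrue {suc n} f = (if f zero then 1 else 0) Data.Nat.+ countTrue (λ i → f (suc i))

module _ {n : ℕ} (G : Graph n) where
  open Graph G

  deg : Fin n → ℕ
  deg v = countTrue (adj v)

  data Reach : Fin n → Fin n → Set where
    here : ∀ {v} → Reach v v
    step : ∀ {u w v} → adj u w ≡ true → Reach w v → Reach u v

  Connected : Set
  Connected = ∀ u v → Reach u v

  IsMinDegree : ℕ → Set
  IsMinDegree δ = (∀ v → δ ≤ deg v) × ∃ λ v → deg v ≡ δ

  -- configurations: true = black, false = white
  Config : Set
  Config = Fin n → Bool

  blackNbrs : Config → Fin n → ℕ
  blackNbrs C v = countTrue (λ u → adj v u ∧ C u)

  round : ℚ → Config → Config
  round α C v = C v ∨ (α * ℕtoℚ (deg v) ≤ᵇ ℕtoℚ (blackNbrs C v))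

  iter : ℚ → ℕ → Config → Config
  iter α zero    C = C
  iter α (suc t) C = round α (iter α t C)

  IsDynamo : ℚ → Subset n → Set
  IsDynamo α D = ∀ (C₀ : Config) → (∀ v → v ∈ D → C₀ v ≡ true) →
                 ∃ λ t → ∀ v → iter α t C₀ v ≡ true

  IsMD : ℚ → ℕ → Set
  IsMD α m = (∃ λ D → IsDynamo α D × ∣ D ∣ ≡ m) × (∀ D → IsDynamo α D → m ≤ ∣ D ∣)

-- Give every vertex u the threshold t u = ⌈α·deg u⌉ ≤ deg u.  For S ⊆ V, think of the
-- vertices outside S as already black; u ∈ S then still needs r_S(u) = t u ∸ #(neighbours
-- outside S) further black neighbours.  Put Φ(S) = Σ_{u ∈ S} r_S(u) / (d_S(u) + 1), where
-- d_S(u) counts the neighbours in S.  Taking a vertex v out of S costs 1 if r_S(v) > 0 (v goes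
-- into the dynamo) and 0 otherwise (v turns black one round later); averaged over v ∈ S, this
-- cost plus Φ(S − v) is exactly Φ(S).  So always removing a vertex of at most average cost
-- builds a dynamo of size at most Φ(V) = Σ_u t u / (deg u + 1) ≤ n (αδ + 1) / (δ + 1), because
-- (αd + 1)/(d + 1) decreases in d.  This is the random-ordering argument, derandomised.
-- For the lower bound: if α > 0 and no vertex is isolated, the all-white configuration stays
-- all-white, so the empty set is not a dynamo.

module Submission where

open import Defs
open import Data.Bool using (Bool; true; false; _∧_; _∨_; not; if_then_else_)
open import Data.Bool.Properties using (∧-zeroʳ; ∧-identityʳ; ∧-comm; ∨-zeroʳ)
open import Data.Fin using (Fin; zero; suc; punchIn)
open import Data.Fin.Properties using (_≟_; any?; punchInᵢ≢i)
open import Data.Product using (∃; _×_; _,_; proj₁; proj₂)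
open import Relation.Nullary using (does; yes; no; ¬_; contradiction)
open import Relation.Nullary.Decidable using (dec-true; dec-false; _×-dec_)
open import Relation.Binary.PropositionalEquality
open import Function using (_∘_)

module Counting where

  open import Data.Nat using (ℕ; zero; suc; _+_; _*_; _≤_; z≤n; s≤s; _≤?_; >-nonZero)
  open import Data.Nat.Properties hiding (_≟_)
  open import Data.Vec using (tabulate)
  open import Data.Vec.Properties using (lookup∘tabulate; lookup⇒[]=)
  open import Data.Fin.Subset using (Subset; _∈_; ∣_∣)
  open import Data.Fin.Subset.Properties using (∣⁅x⁆∣≡1; p⊆q⇒∣p∣≤∣q∣; x∈⁅y⁆⇒x≡y)
  open import Algebra.Properties.Semiring.Sum +-*-semiring using (sum)

  private
    variable
      n : ℕ

  _─_ : (Fin n → Bool) → Fin n → Fin n → Bool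
  (S ─ v) w = not (does (v ≟ w)) ∧ S w

  ⁅_⁆ : Fin n → Fin n → Bool
  ⁅ v ⁆ w = does (v ≟ w)

  ─-self : (S : Fin n → Bool) (v : Fin n) → (S ─ v) v ≡ false
  ─-self S v rewrite dec-true (v ≟ v) refl = refl

  ─-other : (S : Fin n → Bool) {v w : Fin n} → v ≢ w → (S ─ v) w ≡ S w
  ─-other S {v} {w} v≢w rewrite dec-false (v ≟ w) v≢w = refl

  ─-⊆ : (S : Fin n → Bool) (v : Fin n) {w : Fin n} → S w ≡ false → (S ─ v) w ≡ false
  ─-⊆ S v {w} Sw rewrite Sw = ∧-zeroʳ _

  countTrue-cong : {f g : Fin n → Bool} → f ≗ g → countTrue f ≡ countTrue g
  countTrue-cong {zero}  f≗g = refl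
  countTrue-cong {suc n} f≗g =
    cong₂ _+_ (cong (λ b → if b then 1 else 0) (f≗g zero)) (countTrue-cong (λ i → f≗g (suc i)))

  countTrue≤n : (f : Fin n → Bool) → countTrue f ≤ n
  countTrue≤n {zero}  f = z≤n
  countTrue≤n {suc n} f with f zero
  ... | true  = s≤s (countTrue≤n (λ i → f (suc i)))
  ... | false = m≤n⇒m≤1+n (countTrue≤n (λ i → f (suc i)))

  countTrue-mono : {f g : Fin n → Bool} → (∀ i → f i ≡ true → g i ≡ true) → countTrue f ≤ countTrue g
  countTrue-mono {zero}  f⊆g = z≤n
  countTrue-mono {suc n} {f} {g} f⊆g with f zero | g zero | f⊆g zero
  ... | true  | true  | _ = s≤s (countTrue-mono (λ i → f⊆g (suc i)))
  ... | true  | false | h with () ← h refl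
  ... | false | true  | _ = m≤n⇒m≤1+n (countTrue-mono (λ i → f⊆g (suc i)))
  ... | false | false | _ = countTrue-mono (λ i → f⊆g (suc i))

  countTrue-false : countTrue {n} (λ _ → false) ≡ 0
  countTrue-false {zero}  = refl
  countTrue-false {suc n} = countTrue-false {n}

  countTrue-pos : (f : Fin n → Bool) (i : Fin n) → f i ≡ true → 1 ≤ countTrue f
  countTrue-pos f zero    fi rewrite fi = s≤s z≤n
  countTrue-pos f (suc i) fi with f zero
  ... | true  = s≤s z≤n
  ... | false = countTrue-pos (λ j → f (suc j)) i fi

  countTrue≡0 : (f : Fin n → Bool) → countTrue f ≡ 0 → ∀ i → f i ≡ false
  countTrue≡0 f #f≡0 i with f i in fi
  ... | false = refl
  ... | true with () ← subst (1 ≤_) #f≡0 (countTrue-pos f i fi)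

  countTrue-─ : (f : Fin n → Bool) (v : Fin n) → countTrue f ≡ countTrue (f ─ v) + (if f v then 1 else 0)
  countTrue-─ {suc n} f zero    = +-comm (if f zero then 1 else 0) _
  countTrue-─ {suc n} f (suc v) =
    trans (cong ((if f zero then 1 else 0) +_) (countTrue-─ (λ i → f (suc i)) v))
          (sym (+-assoc (if f zero then 1 else 0) _ _))

  countTrue-─-∈ : (f : Fin n → Bool) {v : Fin n} → f v ≡ true → countTrue f ≡ suc (countTrue (f ─ v))
  countTrue-─-∈ f {v} fv =
    trans (countTrue-─ f v) (trans (cong (λ b → countTrue (f ─ v) + (if b then 1 else 0)) fv) (+-comm _ 1))

  countTrue-⁅⁆ : (v : Fin n) → countTrue ⁅ v ⁆ ≡ 1
  countTrue-⁅⁆ {suc n} zero    = cong suc (countTrue-false {n})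
  countTrue-⁅⁆ {suc n} (suc v) = countTrue-⁅⁆ v

  countTrue-∨ : (f g : Fin n → Bool) → countTrue (λ i → f i ∨ g i) ≤ countTrue f + countTrue g
  countTrue-∨ {zero}  f g = z≤n
  countTrue-∨ {suc n} f g with f zero | g zero | countTrue-∨ (λ i → f (suc i)) (λ i → g (suc i))
  ... | true  | true  | ih = s≤s (≤-trans ih (+-monoʳ-≤ _ (n≤1+n _)))
  ... | true  | false | ih = s≤s ih
  ... | false | true  | ih = ≤-trans (s≤s ih) (≤-reflexive (sym (+-suc _ _)))
  ... | false | false | ih = ih

  countTrue-∧-not : (f g : Fin n → Bool) →
    countTrue (λ i → f i ∧ g i) + countTrue (λ i → f i ∧ not (g i)) ≡ countTrue f
  countTrue-∧-not {zero}  f g = refl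
  countTrue-∧-not {suc n} f g with f zero | g zero | countTrue-∧-not (λ i → f (suc i)) (λ i → g (suc i))
  ... | true  | true  | ih = cong suc ih
  ... | true  | false | ih = trans (+-suc _ _) (cong suc ih)
  ... | false | _     | ih = ih

  ∣tabulate∣≡countTrue : (f : Fin n → Bool) → ∣ tabulate f ∣ ≡ countTrue f
  ∣tabulate∣≡countTrue {zero}  f = refl
  ∣tabulate∣≡countTrue {suc n} f with f zero
  ... | true  = cong suc (∣tabulate∣≡countTrue (λ i → f (suc i)))
  ... | false = ∣tabulate∣≡countTrue (λ i → f (suc i))

  ∈-tabulate : (f : Fin n → Bool) {v : Fin n} → f v ≡ true → v ∈ tabulate f
  ∈-tabulate f {v} fv = lookup⇒[]= v (tabulate f) (trans (lookup∘tabulate f v) fv)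

  ∈⇒∣p∣≥1 : {p : Subset n} {v : Fin n} → v ∈ p → 1 ≤ ∣ p ∣
  ∈⇒∣p∣≥1 {p = p} {v} v∈p = subst (_≤ ∣ p ∣) (∣⁅x⁆∣≡1 v)
    (p⊆q⇒∣p∣≤∣q∣ (λ x∈⁅v⁆ → subst (_∈ p) (sym (x∈⁅y⁆⇒x≡y v x∈⁅v⁆)) v∈p))

  sum-if : (f : Fin n → Bool) (c : ℕ) → sum (λ i → if f i then c else 0) ≡ countTrue f * c
  sum-if {zero}  f c = refl
  sum-if {suc n} f c with f zero
  ... | true  = cong (c +_) (sum-if (λ i → f (suc i)) c)
  ... | false = sum-if (λ i → f (suc i)) c

  sum-mono-≤ : {f g : Fin n → ℕ} → (∀ i → f i ≤ g i) → sum f ≤ sum g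
  sum-mono-≤ {zero}  f≤g = z≤n
  sum-mono-≤ {suc n} f≤g = +-mono-≤ (f≤g zero) (sum-mono-≤ (λ i → f≤g (suc i)))

  exists-≤-average : (S : Fin n → Bool) (g : Fin n → ℕ) {x : ℕ} → 1 ≤ countTrue S →
    sum (λ v → if S v then g v else 0) ≤ countTrue S * x → ∃ λ v → S v ≡ true × g v ≤ x
  exists-≤-average S g {x} S≢∅ Σg≤ with any? (λ v → (S v Data.Bool.≟ true) ×-dec (g v ≤? x))
  ... | yes witness = witness
  ... | no  none    = contradiction Σg≤ (<⇒≱ (begin-strict
      countTrue S * x                           <⟨ *-monoʳ-< (countTrue S) {{>-nonZero S≢∅}} ≤-refl ⟩
      countTrue S * suc x                       ≡⟨ sum-if S (suc x) ⟨
      sum (λ v → if S v then suc x else 0)      ≤⟨ sum-mono-≤ above ⟩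
      sum (λ v → if S v then g v else 0)        ∎))
    where
    open ≤-Reasoning
    above : ∀ v → (if S v then suc x else 0) ≤ (if S v then g v else 0)
    above v with S v in Sv
    ... | true  = ≰⇒> (λ gv≤x → none (v , Sv , gv≤x))
    ... | false = z≤n

module RationalArithmetic where

  open import Data.Nat as ℕ using (ℕ; zero; suc; z≤n)
  open import Data.Nat.Properties as ℕ using (+-*-semiring)
  open import Data.Nat.Coprimality as Coprimality using (1-coprimeTo)
  open import Data.Integer as ℤ using (+_)
  import Data.Integer.Properties as ℤ
  open import Data.Rational
  open import Data.Rational.Properties
  open import Data.Rational.Solver using (module +-*-Solver)
  open import Algebra.Properties.Semiring.Sum +-*-semiring using (sum; *-distribʳ-sum)
  open +-*-Solver

  ℕtoℚ≡mkℚ : ∀ k → ℕtoℚ k ≡ mkℚ (+ k) 0 (Coprimality.sym (1-coprimeTo k))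
  ℕtoℚ≡mkℚ k = normalize-coprime (Coprimality.sym (1-coprimeTo k))

  ℕtoℚ-+ : ∀ a b → ℕtoℚ (a ℕ.+ b) ≡ ℕtoℚ a + ℕtoℚ b
  ℕtoℚ-+ a b rewrite ℕtoℚ≡mkℚ a | ℕtoℚ≡mkℚ b | ℤ.*-identityʳ (+ a) | ℤ.*-identityʳ (+ b) = refl

  ℕtoℚ-* : ∀ a b → ℕtoℚ (a ℕ.* b) ≡ ℕtoℚ a * ℕtoℚ b
  ℕtoℚ-* a b rewrite ℕtoℚ≡mkℚ a | ℕtoℚ≡mkℚ b = cong (_/ 1) (ℤ.pos-* a b)

  ℕtoℚ-suc : ∀ k → ℕtoℚ (suc k) ≡ ℕtoℚ k + 1ℚ
  ℕtoℚ-suc k = trans (ℕtoℚ-+ 1 k) (+-comm 1ℚ (ℕtoℚ k))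

  ℕtoℚ-mono-≤ : ∀ {a b} → a ℕ.≤ b → ℕtoℚ a ≤ ℕtoℚ b
  ℕtoℚ-mono-≤ {a} {b} a≤b rewrite ℕtoℚ≡mkℚ a | ℕtoℚ≡mkℚ b
    = *≤* (subst₂ ℤ._≤_ (sym (ℤ.*-identityʳ (+ a))) (sym (ℤ.*-identityʳ (+ b))) (ℤ.+≤+ a≤b))

  ℕtoℚ-nonNegative : ∀ k → NonNegative (ℕtoℚ k)
  ℕtoℚ-nonNegative k rewrite ℕtoℚ≡mkℚ k = _

  ℕtoℚ-positive : ∀ {k} → 1 ℕ.≤ k → Positive (ℕtoℚ k)
  ℕtoℚ-positive {suc k} _ rewrite ℕtoℚ≡mkℚ (suc k) = _

  ℕtoℚ-sum-≤ : ∀ {n} (f : Fin n → ℕ) {c} → (∀ i → ℕtoℚ (f i) ≤ c) → ℕtoℚ (sum f) ≤ ℕtoℚ n * c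
  ℕtoℚ-sum-≤ {zero}  f {c} _   = ≤-reflexive (sym (*-zeroˡ c))
  ℕtoℚ-sum-≤ {suc n} f {c} f≤c = begin
    ℕtoℚ (f zero ℕ.+ sum (λ i → f (suc i)))       ≡⟨ ℕtoℚ-+ (f zero) _ ⟩
    ℕtoℚ (f zero) + ℕtoℚ (sum (λ i → f (suc i)))  ≤⟨ +-mono-≤ (f≤c zero) (ℕtoℚ-sum-≤ (λ i → f (suc i)) (λ i → f≤c (suc i))) ⟩
    c + ℕtoℚ n * c                                ≡⟨ solve 2 (λ c m → c :+ m :* c := (m :+ con 1ℚ) :* c) refl c (ℕtoℚ n) ⟩
    (ℕtoℚ n + 1ℚ) * c                             ≡⟨ cong (_* c) (ℕtoℚ-suc n) ⟨
    ℕtoℚ (suc n) * c                              ∎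
    where open ≤-Reasoning

  reciprocal-nonNegative : ∀ k → NonNegative ((+ 1) / suc k)
  reciprocal-nonNegative k = normalize-nonNeg 1 (suc k)

  ℕtoℚ*reciprocal : ∀ k → ℕtoℚ (suc k) * ((+ 1) / suc k) ≡ 1ℚ
  ℕtoℚ*reciprocal k rewrite ℕtoℚ≡mkℚ (suc k) | normalize-coprime {1} {k} (1-coprimeTo (suc k)) =
    *-inverseʳ (mkℚ (+ suc k) 0 (Coprimality.sym (1-coprimeTo (suc k))))

  p≤p+1 : ∀ p → p ≤ p + 1ℚ
  p≤p+1 p = subst (_≤ p + 1ℚ) (+-identityʳ p) (+-monoʳ-≤ p (ℕtoℚ-mono-≤ {0} {1} z≤n))

  nat-ceiling : ∀ x d → 0ℚ ≤ x → x ≤ ℕtoℚ d → ∃ λ k → k ℕ.≤ d × x ≤ ℕtoℚ k × ℕtoℚ k ≤ x + 1ℚ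
  nat-ceiling x zero    0≤x x≤0 = 0 , z≤n , x≤0 , ≤-trans 0≤x (p≤p+1 x)
  nat-ceiling x (suc d) 0≤x x≤d+1 with x ≤? ℕtoℚ d
  ... | yes x≤d = let k , k≤d , x≤k , k≤x+1 = nat-ceiling x d 0≤x x≤d in k , ℕ.m≤n⇒m≤1+n k≤d , x≤k , k≤x+1
  ... | no  x≰d = suc d , ℕ.≤-refl , x≤d+1 ,
                  subst (_≤ x + 1ℚ) (sym (ℕtoℚ-suc d)) (+-monoˡ-≤ 1ℚ (<⇒≤ (≰⇒> x≰d)))

  scaled-ceiling : ∀ {a} → 0ℚ ≤ a → a ≤ 1ℚ → ∀ d →
    ∃ λ k → k ℕ.≤ d × a * ℕtoℚ d ≤ ℕtoℚ k × ℕtoℚ k ≤ a * ℕtoℚ d + 1ℚ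
  scaled-ceiling {a} 0≤a a≤1 d = nat-ceiling (a * ℕtoℚ d) d
    (subst (_≤ a * ℕtoℚ d) (*-zeroˡ (ℕtoℚ d)) (*-monoʳ-≤-nonNeg (ℕtoℚ d) {{ℕtoℚ-nonNegative d}} 0≤a))
    (subst (a * ℕtoℚ d ≤_) (*-identityˡ (ℕtoℚ d)) (*-monoʳ-≤-nonNeg (ℕtoℚ d) {{ℕtoℚ-nonNegative d}} a≤1))

  -- (a y + 1) / (y + 1) ≤ (a x + 1) / (x + 1) for y = x + e, with the denominators cleared.
  affine-ratio-antitone : ∀ a x e .{{_ : NonNegative e}} → a ≤ 1ℚ →
    (a * (x + e) + 1ℚ) * (x + 1ℚ) ≤ (a * x + 1ℚ) * (x + e + 1ℚ)
  affine-ratio-antitone a x e a≤1 = begin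
    (a * (x + e) + 1ℚ) * (x + 1ℚ)
      ≡⟨ solve 3 (λ a x e → (a :* (x :+ e) :+ con 1ℚ) :* (x :+ con 1ℚ)
                         := (a :* x :+ con 1ℚ) :* (x :+ con 1ℚ) :+ a :* e :* x :+ a :* e) refl a x e ⟩
    common + a * e
      ≤⟨ +-monoʳ-≤ common (*-monoʳ-≤-nonNeg e a≤1) ⟩
    common + 1ℚ * e
      ≡⟨ solve 3 (λ a x e → (a :* x :+ con 1ℚ) :* (x :+ con 1ℚ) :+ a :* e :* x :+ con 1ℚ :* e
                         := (a :* x :+ con 1ℚ) :* (x :+ e :+ con 1ℚ)) refl a x e ⟩
    (a * x + 1ℚ) * (x + e + 1ℚ) ∎
    where
    open ≤-Reasoning
    common : ℚ
    common = (a * x + 1ℚ) * (x + 1ℚ) + a * e * x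

  threshold-share : ∀ {α} δ d k Q {L} → α ≤ 1ℚ → δ ℕ.≤ d → ℕtoℚ k ≤ α * ℕtoℚ d + 1ℚ → suc d ℕ.* Q ≡ L →
    ℕtoℚ (k ℕ.* Q ℕ.* suc δ) ≤ (α * ℕtoℚ δ + 1ℚ) * ℕtoℚ L
  threshold-share {α} δ d k Q {L} α≤1 δ≤d k≤αd+1 [d+1]Q≡L = begin
    ℕtoℚ (k ℕ.* Q ℕ.* suc δ)
      ≡⟨ trans (ℕtoℚ-* (k ℕ.* Q) (suc δ)) (cong (_* ℕtoℚ (suc δ)) (ℕtoℚ-* k Q)) ⟩
    ℕtoℚ k * ℕtoℚ Q * ℕtoℚ (suc δ)
      ≡⟨ solve 3 (λ k Q S → k :* Q :* S := k :* S :* Q) refl (ℕtoℚ k) (ℕtoℚ Q) (ℕtoℚ (suc δ)) ⟩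
    ℕtoℚ k * ℕtoℚ (suc δ) * ℕtoℚ Q
      ≤⟨ *-monoʳ-≤-nonNeg (ℕtoℚ Q) {{ℕtoℚ-nonNegative Q}}
           (*-monoʳ-≤-nonNeg (ℕtoℚ (suc δ)) {{ℕtoℚ-nonNegative (suc δ)}} k≤αd+1) ⟩
    (α * ℕtoℚ d + 1ℚ) * ℕtoℚ (suc δ) * ℕtoℚ Q
      ≡⟨ cong₂ (λ x y → (α * x + 1ℚ) * y * ℕtoℚ Q) d≡δ+e (ℕtoℚ-suc δ) ⟩
    (α * (Δ + E) + 1ℚ) * (Δ + 1ℚ) * ℕtoℚ Q
      ≤⟨ *-monoʳ-≤-nonNeg (ℕtoℚ Q) {{ℕtoℚ-nonNegative Q}}
           (affine-ratio-antitone α Δ E {{ℕtoℚ-nonNegative (d ℕ.∸ δ)}} α≤1) ⟩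
    (α * Δ + 1ℚ) * (Δ + E + 1ℚ) * ℕtoℚ Q
      ≡⟨ *-assoc (α * Δ + 1ℚ) _ _ ⟩
    (α * Δ + 1ℚ) * ((Δ + E + 1ℚ) * ℕtoℚ Q)
      ≡⟨ cong (λ x → (α * Δ + 1ℚ) * (x * ℕtoℚ Q)) (trans (ℕtoℚ-suc d) (cong (_+ 1ℚ) d≡δ+e)) ⟨
    (α * Δ + 1ℚ) * (ℕtoℚ (suc d) * ℕtoℚ Q)
      ≡⟨ cong ((α * Δ + 1ℚ) *_) (trans (sym (ℕtoℚ-* (suc d) Q)) (cong ℕtoℚ [d+1]Q≡L)) ⟩
    (α * Δ + 1ℚ) * ℕtoℚ L ∎
    where
    open ≤-Reasoning
    Δ E : ℚ
    Δ = ℕtoℚ δ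
    E = ℕtoℚ (d ℕ.∸ δ)
    d≡δ+e : ℕtoℚ d ≡ Δ + E
    d≡δ+e = trans (cong ℕtoℚ (sym (ℕ.m+[n∸m]≡n δ≤d))) (ℕtoℚ-+ δ (d ℕ.∸ δ))

  mean-bound : ∀ {n} (w : Fin n → ℕ) {L m s : ℕ} {A : ℚ} → 1 ℕ.≤ L → L ℕ.* m ℕ.≤ sum w →
    (∀ u → ℕtoℚ (w u ℕ.* s) ≤ A * ℕtoℚ L) → ℕtoℚ m * ℕtoℚ s ≤ ℕtoℚ n * A
  mean-bound {n} w {L} {m} {s} {A} L≥1 Lm≤Σw ws≤AL =
    *-cancelˡ-≤-pos (ℕtoℚ L) {{ℕtoℚ-positive L≥1}} (begin
      ℕtoℚ L * (ℕtoℚ m * ℕtoℚ s)    ≡⟨ *-assoc (ℕtoℚ L) _ _ ⟨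
      ℕtoℚ L * ℕtoℚ m * ℕtoℚ s      ≡⟨ trans (ℕtoℚ-* (L ℕ.* m) s) (cong (_* ℕtoℚ s) (ℕtoℚ-* L m)) ⟨
      ℕtoℚ (L ℕ.* m ℕ.* s)          ≤⟨ ℕtoℚ-mono-≤ (ℕ.*-monoˡ-≤ s Lm≤Σw) ⟩
      ℕtoℚ (sum w ℕ.* s)            ≡⟨ cong ℕtoℚ (*-distribʳ-sum s w) ⟩
      ℕtoℚ (sum (λ u → w u ℕ.* s))  ≤⟨ ℕtoℚ-sum-≤ (λ u → w u ℕ.* s) ws≤AL ⟩
      ℕtoℚ n * (A * ℕtoℚ L)         ≡⟨ solve 3 (λ n A L → n :* (A :* L) := L :* (n :* A)) refl (ℕtoℚ n) A (ℕtoℚ L) ⟩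
      ℕtoℚ L * (ℕtoℚ n * A)         ∎)
    where open ≤-Reasoning

  bound-rearranged : ∀ α .{{_ : NonZero α}} δ m n → ℕtoℚ m * ℕtoℚ (suc δ) ≤ ℕtoℚ n * (α * ℕtoℚ δ + 1ℚ) →
    ℕtoℚ m ≤ (ℕtoℚ δ + 1/ α) * ((+ 1) / suc δ) * α * ℕtoℚ n
  bound-rearranged α δ m n m[δ+1]≤n[αδ+1] = begin
    ℕtoℚ m                                    ≡⟨ *-identityʳ (ℕtoℚ m) ⟨
    ℕtoℚ m * 1ℚ                               ≡⟨ cong (ℕtoℚ m *_) (ℕtoℚ*reciprocal δ) ⟨
    ℕtoℚ m * (ℕtoℚ (suc δ) * r)               ≡⟨ *-assoc (ℕtoℚ m) _ _ ⟨
    ℕtoℚ m * ℕtoℚ (suc δ) * r                 ≤⟨ *-monoʳ-≤-nonNeg r {{reciprocal-nonNegative δ}} m[δ+1]≤n[αδ+1] ⟩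
    ℕtoℚ n * (α * ℕtoℚ δ + 1ℚ) * r            ≡⟨ cong (λ x → ℕtoℚ n * (α * ℕtoℚ δ + x) * r) (*-inverseˡ α) ⟨
    ℕtoℚ n * (α * ℕtoℚ δ + 1/ α * α) * r      ≡⟨ solve 5 (λ n a d z r → n :* (a :* d :+ z :* a) :* r := (d :+ z) :* r :* a :* n)
                                                    refl (ℕtoℚ n) α (ℕtoℚ δ) (1/ α) r ⟩
    (ℕtoℚ δ + 1/ α) * r * α * ℕtoℚ n          ∎
    where
    open ≤-Reasoning
    r : ℚ
    r = (+ 1) / suc δ

open import Data.Nat as ℕ using (ℕ; suc; _≤_; s≤s; _!)
open import Data.Nat.Divisibility using (_∣_; ∣-trans; m∣m*n; m≤n⇒m!∣n!)
import Data.Rational as ℚ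

1+d∣[1+n]! : ∀ {d n} → d ≤ n → suc d ∣ suc n !
1+d∣[1+n]! {d} d≤n = ∣-trans (m∣m*n (d !)) (m≤n⇒m!∣n! (s≤s d≤n))

module Potential {n : ℕ} (G : Graph n) (t : Fin n → ℕ) (t≤deg : ∀ u → t u ≤ deg G u)
                 (L : ℕ) (L-common : ∀ {d} → d ≤ n → suc d ∣ L) where

  open import Data.Nat using (zero; _+_; _*_; _∸_)
  open import Data.Nat.Properties hiding (_≟_)
  open import Data.Nat.DivMod using (_/_; m*[n/m]≡n)
  open import Data.Nat.Solver using (module +-*-Solver)
  open import Algebra.Properties.Semiring.Sum +-*-semiring
    using (sum; sum-cong-≗; ∑-distrib-+; ∑-comm; *-distribʳ-sum)
  open Graph G using (adj; irrefl)
  open Counting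

  q : ℕ → ℕ
  q d = L / suc d

  q-spec : ∀ {d} → d ≤ n → suc d * q d ≡ L
  q-spec d≤n = m*[n/m]≡n (L-common d≤n)

  inNbrs outNbrs nonNbrs residual weight : (Fin n → Bool) → Fin n → ℕ
  inNbrs   S u = countTrue (λ w → adj u w ∧ S w)
  outNbrs  S u = countTrue (λ w → adj u w ∧ not (S w))
  nonNbrs  S u = countTrue (λ w → (S ─ u) w ∧ not (adj u w))
  residual S u = t u ∸ outNbrs S u
  weight   S u = if S u then residual S u * q (inNbrs S u) else 0

  -- Since L / (d + 1) is exact for d ≤ n, Φ S is L times Σ_{u ∈ S} residual S u / (inNbrs S u + 1).
  Φ : (Fin n → Bool) → ℕ
  Φ S = sum (weight S)

  joinCost : ℕ → ℕ
  joinCost zero    = 0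
  joinCost (suc _) = L

  removalCost : (Fin n → Bool) → Fin n → ℕ
  removalCost S v = joinCost (residual S v) + Φ (S ─ v)

  inNbrs+outNbrs : ∀ S u → inNbrs S u + outNbrs S u ≡ deg G u
  inNbrs+outNbrs S u = countTrue-∧-not (adj u) S

  residual≤inNbrs : ∀ S u → residual S u ≤ inNbrs S u
  residual≤inNbrs S u = begin
    t u ∸ outNbrs S u                        ≤⟨ ∸-monoˡ-≤ (outNbrs S u) (t≤deg u) ⟩
    deg G u ∸ outNbrs S u                    ≡⟨ cong (_∸ outNbrs S u) (inNbrs+outNbrs S u) ⟨
    inNbrs S u + outNbrs S u ∸ outNbrs S u   ≡⟨ m+n∸n≡m (inNbrs S u) (outNbrs S u) ⟩
    inNbrs S u                               ∎
    where open ≤-Reasoning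

  inNbrs-split : ∀ S u v → inNbrs S u ≡ inNbrs (S ─ v) u + (if adj u v ∧ S v then 1 else 0)
  inNbrs-split S u v =
    trans (countTrue-─ (λ w → adj u w ∧ S w) v) (cong (_+ _) (countTrue-cong exchange))
    where
    exchange : ∀ w → ((λ w → adj u w ∧ S w) ─ v) w ≡ adj u w ∧ (S ─ v) w
    exchange w with adj u w
    ... | true  = refl
    ... | false = ∧-zeroʳ _

  inNbrs-─ : ∀ S u v → inNbrs (S ─ v) u ≡ inNbrs S u ∸ (if adj u v ∧ S v then 1 else 0)
  inNbrs-─ S u v =
    trans (sym (m+n∸n≡m (inNbrs (S ─ v) u) uv)) (cong (_∸ uv) (sym (inNbrs-split S u v)))
    where
    uv : ℕ
    uv = if adj u v ∧ S v then 1 else 0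

  outNbrs-─ : ∀ S u v → outNbrs (S ─ v) u ≡ outNbrs S u + (if adj u v ∧ S v then 1 else 0)
  outNbrs-─ S u v = +-cancelˡ-≡ (inNbrs (S ─ v) u) _ _ (begin
    inNbrs (S ─ v) u + outNbrs (S ─ v) u      ≡⟨ inNbrs+outNbrs (S ─ v) u ⟩
    deg G u                                    ≡⟨ inNbrs+outNbrs S u ⟨
    inNbrs S u + outNbrs S u                   ≡⟨ cong (_+ outNbrs S u) (inNbrs-split S u v) ⟩
    inNbrs (S ─ v) u + uv + outNbrs S u        ≡⟨ +-assoc (inNbrs (S ─ v) u) uv _ ⟩
    inNbrs (S ─ v) u + (uv + outNbrs S u)      ≡⟨ cong (inNbrs (S ─ v) u +_) (+-comm uv _) ⟩
    inNbrs (S ─ v) u + (outNbrs S u + uv)      ∎)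
    where
    open ≡-Reasoning
    uv : ℕ
    uv = if adj u v ∧ S v then 1 else 0

  residual-─ : ∀ S u v → residual (S ─ v) u ≡ residual S u ∸ (if adj u v ∧ S v then 1 else 0)
  residual-─ S u v = trans (cong (t u ∸_) (outNbrs-─ S u v)) (sym (∸-+-assoc (t u) (outNbrs S u) _))

  removal-weight : ∀ S u → S u ≡ true → ∀ v →
    (if S v then weight (S ─ v) u else 0) ≡
    (if adj u v ∧ S v then (residual S u ∸ 1) * q (inNbrs S u ∸ 1) else 0) +
    (if (S ─ u) v ∧ not (adj u v) then residual S u * q (inNbrs S u) else 0)
  removal-weight S u Su v with v ≟ u
  ... | yes refl rewrite ─-self S u | irrefl u | Su = refl
  ... | no v≢u rewrite ─-other S (v≢u ∘ sym) | Su
                     | inNbrs-─ S u v | residual-─ S u v with S v | adj u v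
  ... | false | false = refl
  ... | false | true  = refl
  ... | true  | true  = sym (+-identityʳ _)
  ... | true  | false = refl

  sum-removal-weight : ∀ S u → S u ≡ true →
    sum (λ v → if S v then weight (S ─ v) u else 0) ≡
    inNbrs S u * ((residual S u ∸ 1) * q (inNbrs S u ∸ 1)) + nonNbrs S u * (residual S u * q (inNbrs S u))
  sum-removal-weight S u Su =
    trans (sum-cong-≗ (removal-weight S u Su))
          (trans (∑-distrib-+ (λ v → if nbr v then B else 0) (λ v → if other v then C else 0))
                 (cong₂ _+_ (sum-if nbr B) (sum-if other C)))
    where
    nbr other : Fin n → Bool
    nbr   v = adj u v ∧ S v
    other v = (S ─ u) v ∧ not (adj u v)
    B C : ℕ
    B = (residual S u ∸ 1) * q (inNbrs S u ∸ 1)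
    C = residual S u * q (inNbrs S u)

  countTrue-member : ∀ S u → S u ≡ true → countTrue S ≡ inNbrs S u + nonNbrs S u + 1
  countTrue-member S u Su = begin
    countTrue S
      ≡⟨ countTrue-─ S u ⟩
    countTrue (S ─ u) + (if S u then 1 else 0)
      ≡⟨ cong₂ _+_ (sym (countTrue-∧-not (S ─ u) (adj u))) (cong (λ b → if b then 1 else 0) Su) ⟩
    countTrue (λ w → (S ─ u) w ∧ adj u w) + nonNbrs S u + 1
      ≡⟨ cong (λ k → k + nonNbrs S u + 1) (countTrue-cong nbr) ⟩
    inNbrs S u + nonNbrs S u + 1 ∎
    where
    open ≡-Reasoning
    nbr : ∀ w → (S ─ u) w ∧ adj u w ≡ adj u w ∧ S w
    nbr w with u ≟ w
    ... | yes refl rewrite irrefl u = refl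
    ... | no _     = ∧-comm (S w) (adj u w)

  -- The total weight of a fixed u ∈ S (residual r, d neighbours and c non-neighbours in S) over
  -- the removals of u itself, of one of its neighbours, and of one of the others.
  removal-identity : ∀ r d c → r ≤ d → d ≤ n →
    joinCost r + (d * ((r ∸ 1) * q (d ∸ 1)) + c * (r * q d)) ≡ r * q d * (d + c + 1)
  removal-identity zero    d       c _         _   rewrite *-zeroʳ d | *-zeroʳ c = refl
  removal-identity (suc r) (suc d) c (s≤s r≤d) d<n = begin
    L + (suc d * (r * q d) + c * (suc r * q (suc d)))
      ≡⟨ cong (_+ (suc d * (r * q d) + c * (suc r * q (suc d)))) (q-spec (<⇒≤ d<n)) ⟨
    suc d * q d + (suc d * (r * q d) + c * (suc r * q (suc d)))
      ≡⟨ solve 5 (λ d r c Q Q′ → (con 1 :+ d) :* Q′ :+ ((con 1 :+ d) :* (r :* Q′) :+ c :* ((con 1 :+ r) :* Q))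
                                := (con 1 :+ r) :* ((con 1 :+ d) :* Q′) :+ c :* ((con 1 :+ r) :* Q))
                 refl d r c (q (suc d)) (q d) ⟩
    suc r * (suc d * q d) + c * (suc r * q (suc d))
      ≡⟨ cong (λ x → suc r * x + c * (suc r * q (suc d))) (trans (q-spec (<⇒≤ d<n)) (sym (q-spec d<n))) ⟩
    suc r * (suc (suc d) * q (suc d)) + c * (suc r * q (suc d))
      ≡⟨ solve 4 (λ d r c Q → (con 1 :+ r) :* ((con 2 :+ d) :* Q) :+ c :* ((con 1 :+ r) :* Q)
                             := (con 1 :+ r) :* Q :* ((con 1 :+ d) :+ c :+ con 1))
                 refl d r c (q (suc d)) ⟩
    suc r * q (suc d) * (suc d + c + 1) ∎
    where
    open ≡-Reasoning
    open +-*-Solver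

  removals-outside : ∀ S u → S u ≡ false → sum (λ v → if S v then weight (S ─ v) u else 0) ≡ 0
  removals-outside S u Su = trans (sum-cong-≗ vanish) (trans (sum-if S 0) (*-zeroʳ (countTrue S)))
    where
    vanish : ∀ v → (if S v then weight (S ─ v) u else 0) ≡ (if S v then 0 else 0)
    vanish v = cong (λ b → if S v then (if b then residual (S ─ v) u * q (inNbrs (S ─ v) u) else 0) else 0)
                    (─-⊆ S v Su)

  removals-inside : ∀ S u → S u ≡ true →
    joinCost (residual S u) + sum (λ v → if S v then weight (S ─ v) u else 0)
      ≡ residual S u * q (inNbrs S u) * countTrue S
  removals-inside S u Su = begin
    joinCost r + sum (λ v → if S v then weight (S ─ v) u else 0)
      ≡⟨ cong (joinCost r +_) (sum-removal-weight S u Su) ⟩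
    joinCost r + (d * ((r ∸ 1) * q (d ∸ 1)) + nonNbrs S u * (r * q d))
      ≡⟨ removal-identity r d (nonNbrs S u) (residual≤inNbrs S u) (countTrue≤n _) ⟩
    r * q d * (d + nonNbrs S u + 1)
      ≡⟨ cong (r * q d *_) (countTrue-member S u Su) ⟨
    r * q d * countTrue S ∎
    where
    open ≡-Reasoning
    r d : ℕ
    r = residual S u
    d = inNbrs S u

  removals-at : ∀ S u →
    (if S u then joinCost (residual S u) else 0) + sum (λ v → if S v then weight (S ─ v) u else 0)
      ≡ weight S u * countTrue S
  removals-at S u = by-membership (S u) refl
    where
    by-membership : ∀ b → S u ≡ b →
      (if b then joinCost (residual S u) else 0) + sum (λ v → if S v then weight (S ─ v) u else 0)
        ≡ (if b then residual S u * q (inNbrs S u) else 0) * countTrue S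
    by-membership false Su = removals-outside S u Su
    by-membership true  Su = removals-inside S u Su

  ∑-removalCost : ∀ S → sum (λ v → if S v then removalCost S v else 0) ≡ countTrue S * Φ S
  ∑-removalCost S = begin
    sum (λ v → if S v then removalCost S v else 0)
      ≡⟨ sum-cong-≗ (λ v → if-+ (S v)) ⟩
    sum (λ v → joins v + (if S v then Φ (S ─ v) else 0))
      ≡⟨ ∑-distrib-+ joins (λ v → if S v then Φ (S ─ v) else 0) ⟩
    sum joins + sum (λ v → if S v then Φ (S ─ v) else 0)
      ≡⟨ cong (sum joins +_) (sum-cong-≗ (λ v → if-sum (S v))) ⟩
    sum joins + sum (λ v → sum (λ u → if S v then weight (S ─ v) u else 0))
      ≡⟨ cong (sum joins +_) (∑-comm (λ v u → if S v then weight (S ─ v) u else 0)) ⟩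
    sum joins + sum (λ u → sum (λ v → if S v then weight (S ─ v) u else 0))
      ≡⟨ ∑-distrib-+ joins (λ u → sum (λ v → if S v then weight (S ─ v) u else 0)) ⟨
    sum (λ u → joins u + sum (λ v → if S v then weight (S ─ v) u else 0))
      ≡⟨ sum-cong-≗ (removals-at S) ⟩
    sum (λ u → weight S u * countTrue S)
      ≡⟨ *-distribʳ-sum (countTrue S) (weight S) ⟨
    Φ S * countTrue S
      ≡⟨ *-comm (Φ S) (countTrue S) ⟩
    countTrue S * Φ S ∎
    where
    open ≡-Reasoning
    joins : Fin n → ℕ
    joins u = if S u then joinCost (residual S u) else 0
    if-+ : ∀ {x y} b → (if b then x + y else 0) ≡ (if b then x else 0) + (if b then y else 0)
    if-+ true  = refl
    if-+ false = refl
    if-sum : ∀ {f : Fin n → ℕ} b → (if b then sum f else 0) ≡ sum (λ u → if b then f u else 0)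
    if-sum true  = refl
    if-sum false = sym (trans (sum-if {n} (λ _ → false) 0) (*-zeroʳ (countTrue {n} (λ _ → false))))

  Φ-all : Φ (λ _ → true) ≡ sum (λ u → t u * q (deg G u))
  Φ-all = sum-cong-≗ λ u →
    cong₂ (λ o d → (t u ∸ o) * q d) no-outNbrs (countTrue-cong (λ w → ∧-identityʳ (adj u w)))
    where
    no-outNbrs : ∀ {u} → outNbrs (λ _ → true) u ≡ 0
    no-outNbrs {u} = trans (countTrue-cong (λ w → ∧-zeroʳ (adj u w))) (countTrue-false {n})

module Bootstrap {n : ℕ} (G : Graph n) (α : ℚ.ℚ) where

  open import Data.Nat using (zero)
  open import Data.Bool.Properties using (T-≡)
  open import Data.Fin.Subset using (∣_∣)
  open import Function using (Equivalence)
  import Data.Rational.Properties as ℚ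

  Percolates : (Fin n → Bool) → Set
  Percolates C = ∃ λ s → ∀ w → iter G α s C w ≡ true

  round-keeps-black : ∀ C {v} → C v ≡ true → round G α C v ≡ true
  round-keeps-black C Cv rewrite Cv = refl

  round-activates : ∀ C {v} → α ℚ.* ℕtoℚ (deg G v) ℚ.≤ ℕtoℚ (blackNbrs G C v) → round G α C v ≡ true
  round-activates C {v} enough =
    trans (cong (C v ∨_) (Equivalence.to T-≡ (ℚ.≤⇒≤ᵇ enough))) (∨-zeroʳ (C v))

  round-cong : ∀ {C C′} → C ≗ C′ → round G α C ≗ round G α C′
  round-cong C≗C′ v =
    cong₂ (λ b k → b ∨ (α ℚ.* ℕtoℚ (deg G v) ℚ.≤ᵇ ℕtoℚ k)) (C≗C′ v)
          (Counting.countTrue-cong (λ w → cong (Graph.adj G v w ∧_) (C≗C′ w)))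

  iter-round : ∀ s C → iter G α s (round G α C) ≗ iter G α (suc s) C
  iter-round zero    C v = refl
  iter-round (suc s) C v = round-cong (iter-round s C) v

  percolates-round : ∀ C → Percolates (round G α C) → Percolates C
  percolates-round C (s , black) = suc s , λ w → trans (sym (iter-round s C w)) (black w)

  white-blackNbrs : ∀ C → (∀ w → C w ≡ false) → ∀ v → blackNbrs G C v ≡ 0
  white-blackNbrs C white v =
    trans (Counting.countTrue-cong (λ w → trans (cong (Graph.adj G v w ∧_) (white w)) (∧-zeroʳ _)))
          (Counting.countTrue-false {n})

  module _ (α>0 : ℚ.0ℚ ℚ.< α) (deg≥1 : ∀ v → 1 ≤ deg G v) where

    α*deg>0 : ∀ v → ℚ.0ℚ ℚ.< α ℚ.* ℕtoℚ (deg G v)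
    α*deg>0 v = ℚ.positive⁻¹ _
      {{ℚ.pos*pos⇒pos α {{ℚ.positive α>0}} _ {{RationalArithmetic.ℕtoℚ-positive (deg≥1 v)}}}}

    round-white : ∀ C → (∀ w → C w ≡ false) → ∀ v → round G α C v ≡ false
    round-white C white v rewrite white v | white-blackNbrs C white v
      with α ℚ.* ℕtoℚ (deg G v) ℚ.≤ᵇ ℚ.0ℚ in αd≤0
    ... | false = refl
    ... | true  = contradiction (ℚ.<-≤-trans (α*deg>0 v) (ℚ.≤ᵇ⇒≤ (Equivalence.from T-≡ αd≤0))) (ℚ.<-irrefl refl)

    iter-white : ∀ s v → iter G α s (λ _ → false) v ≡ false
    iter-white zero    v = refl
    iter-white (suc s) v = round-white (iter G α s (λ _ → false)) (iter-white s) v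

    empty-not-dynamo : Fin n → ∀ D → ∣ D ∣ ≡ 0 → ¬ IsDynamo G α D
    empty-not-dynamo v₀ D |D|≡0 dynamo
      with dynamo (λ _ → false) (λ v v∈D → contradiction (subst (1 ≤_) |D|≡0 (Counting.∈⇒∣p∣≥1 v∈D)) λ ())
    ... | s , black = contradiction (trans (sym (black v₀)) (iter-white s v₀)) λ ()

module Greedy {n : ℕ} (G : Graph n) (α : ℚ.ℚ) (t : Fin n → ℕ) (t≤deg : ∀ u → t u ≤ deg G u)
              (α*deg≤t : ∀ u → α ℚ.* ℕtoℚ (deg G u) ℚ.≤ ℕtoℚ (t u))
              (L : ℕ) (L-common : ∀ {d} → d ≤ n → suc d ∣ L) where

  open import Data.Nat using (zero; _+_; _*_; z≤n)
  open import Data.Nat.Properties hiding (_≟_)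
  open import Data.Vec using (tabulate)
  open import Data.Fin.Subset using (∣_∣)
  open import Algebra.Properties.Semiring.Sum +-*-semiring using (sum)
  import Data.Rational.Properties as ℚ
  open Graph G using (adj)
  open Counting
  open RationalArithmetic using (ℕtoℚ-mono-≤)
  open Potential G t t≤deg L L-common
  open Bootstrap G α

  Activates : (S D : Fin n → Bool) → Set
  Activates S D = ∀ C → (∀ w → S w ≡ false → C w ≡ true) → (∀ w → D w ≡ true → C w ≡ true) → Percolates C

  activates-∅ : ∀ S → countTrue S ≡ 0 → Activates S (λ _ → false)
  activates-∅ S |S|≡0 C outside _ = 0 , λ w → outside w (countTrue≡0 S |S|≡0 w)

  activates-free : ∀ S v D → residual S v ≡ 0 → Activates (S ─ v) D → Activates S D
  activates-free S v D r≡0 act C outside D-black =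
    percolates-round C (act (round G α C) outside′ (λ w Dw → round-keeps-black C (D-black w Dw)))
    where
    outNbrs≤blackNbrs : outNbrs S v ≤ blackNbrs G C v
    outNbrs≤blackNbrs = countTrue-mono black
      where
      black : ∀ w → adj v w ∧ not (S w) ≡ true → adj v w ∧ C w ≡ true
      black w with adj v w | S w in Sw
      ... | true  | false = λ _ → outside w Sw
      ... | true  | true  = λ ()
      ... | false | _     = λ ()
    outside′ : ∀ w → (S ─ v) w ≡ false → round G α C w ≡ true
    outside′ w S─v∌w with v ≟ w
    ... | yes refl = round-activates C (ℚ.≤-trans (α*deg≤t v)
                       (ℕtoℚ-mono-≤ (≤-trans (m∸n≡0⇒m≤n r≡0) outNbrs≤blackNbrs)))
    ... | no  _    = round-keeps-black C (outside w S─v∌w)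

  activates-join : ∀ S v D → Activates (S ─ v) D → Activates S (λ w → ⁅ v ⁆ w ∨ D w)
  activates-join S v D act C outside joined-black = act C outside′ (λ w Dw → joined-black w (D⊆ w Dw))
    where
    D⊆ : ∀ w → D w ≡ true → ⁅ v ⁆ w ∨ D w ≡ true
    D⊆ w Dw rewrite Dw = ∨-zeroʳ (⁅ v ⁆ w)
    outside′ : ∀ w → (S ─ v) w ≡ false → C w ≡ true
    outside′ w S─v∌w with v ≟ w
    ... | yes refl = joined-black v (cong (_∨ D v) (dec-true (v ≟ v) refl))
    ... | no  _    = outside w S─v∌w

  greedy : ∀ k S → countTrue S ≡ k → ∃ λ D → L * countTrue D ≤ Φ S × Activates S D
  greedy zero S |S|≡0 =
    (λ _ → false) , ≤-trans (≤-reflexive (trans (cong (L *_) (countTrue-false {n})) (*-zeroʳ L))) z≤n ,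
    activates-∅ S |S|≡0
  greedy (suc k) S |S|≡1+k
    with exists-≤-average S (removalCost S) (≤-trans (s≤s z≤n) (≤-reflexive (sym |S|≡1+k)))
                          (≤-reflexive (∑-removalCost S))
  ... | v , Sv , cost≤Φ
    with greedy k (S ─ v) (suc-injective (trans (sym (countTrue-─-∈ S Sv)) |S|≡1+k)) | residual S v in r
  ... | D , bound , act | zero  = D , ≤-trans bound cost≤Φ , activates-free S v D r act
  ... | D , bound , act | suc _ = (λ w → ⁅ v ⁆ w ∨ D w) , bound′ , activates-join S v D act
    where
    open ≤-Reasoning
    bound′ : L * countTrue (λ w → ⁅ v ⁆ w ∨ D w) ≤ Φ S
    bound′ = begin
      L * countTrue (λ w → ⁅ v ⁆ w ∨ D w)     ≤⟨ *-monoʳ-≤ L (countTrue-∨ ⁅ v ⁆ D) ⟩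
      L * (countTrue ⁅ v ⁆ + countTrue D)      ≡⟨ cong (λ k → L * (k + countTrue D)) (countTrue-⁅⁆ v) ⟩
      L * suc (countTrue D)                    ≡⟨ *-suc L (countTrue D) ⟩
      L + L * countTrue D                      ≤⟨ +-monoʳ-≤ L bound ⟩
      L + Φ (S ─ v)                            ≤⟨ cost≤Φ ⟩
      Φ S                                      ∎

  small-dynamo : ∃ λ D → IsDynamo G α D × L * ∣ D ∣ ≤ sum (λ u → t u * q (deg G u))
  small-dynamo with greedy _ (λ _ → true) refl
  ... | D , L|D|≤Φ , act =
    tabulate D ,
    (λ C₀ D-black → act C₀ (λ _ ()) (λ w Dw → D-black w (∈-tabulate D Dw))) ,
    subst₂ _≤_ (cong (L *_) (sym (∣tabulate∣≡countTrue D))) Φ-all L|D|≤Φ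

  MD-weight-bound : ∀ {m} → IsMD G α m → L * m ≤ sum (λ u → t u * q (deg G u))
  MD-weight-bound (_ , minimal) with small-dynamo
  ... | D , dynamo , L|D|≤Σ = ≤-trans (*-monoʳ-≤ L (minimal D dynamo)) L|D|≤Σ

connected⇒deg≥1 : ∀ {n} (G : Graph n) → 2 ≤ n → Connected G → ∀ v → 1 ≤ deg G v
connected⇒deg≥1 {suc (suc _)} G (s≤s (s≤s _)) connected v =
  first-step (connected v (punchIn v zero)) (punchInᵢ≢i v zero ∘ sym)
  where
  first-step : ∀ {w} → Reach G v w → v ≢ w → 1 ≤ deg G v
  first-step here                v≢v = contradiction refl v≢v
  first-step (step {w = u} vu _) _   = Counting.countTrue-pos (Graph.adj G v) u vu

open import Data.Integer using (+_)
open import Data.Rational using (ℚ; 0ℚ; 1ℚ; _<_; _+_; _*_; _/_; 1/_; >-nonZero)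

module _ {n : ℕ} (G : Graph n) (α : ℚ) (α>0 : 0ℚ < α) where

  open import Data.Nat using (zero; z≤n)
  open import Data.Nat.Properties using (1≤n!)
  open import Data.Fin using (fromℕ<)
  import Data.Rational.Properties as ℚ
  open RationalArithmetic

  MD-positive : 2 ≤ n → Connected G → ∀ {m} → IsMD G α m → 1 ≤ m
  MD-positive 2≤n connected {zero} ((D , dynamo , |D|≡0) , _) =
    contradiction dynamo
      (Bootstrap.empty-not-dynamo G α α>0 (connected⇒deg≥1 G 2≤n connected) (fromℕ< 2≤n) D |D|≡0)
  MD-positive _ _ {suc _} _ = s≤s z≤n

  MD-upper : α < 1ℚ → ∀ {δ} → (∀ v → δ ≤ deg G v) → ∀ {m} → IsMD G α m →
    ℕtoℚ m ℚ.≤ (ℕtoℚ δ + (1/ α) {{>-nonZero α>0}}) * ((+ 1) / suc δ) * α * ℕtoℚ n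
  MD-upper α<1 {δ} δ≤deg {m} isMD =
    bound-rearranged α {{>-nonZero α>0}} δ m n
      (mean-bound scaledShare (1≤n! (suc n)) (MD-weight-bound isMD) share≤)
    where
    α≤1 : α ℚ.≤ 1ℚ
    α≤1 = ℚ.<⇒≤ α<1
    ceiling : ∀ u → ∃ λ k → k ≤ deg G u × α * ℕtoℚ (deg G u) ℚ.≤ ℕtoℚ k
                                          × ℕtoℚ k ℚ.≤ α * ℕtoℚ (deg G u) + 1ℚ
    ceiling u = scaled-ceiling (ℚ.<⇒≤ α>0) α≤1 (deg G u)
    t : Fin n → ℕ
    t u = proj₁ (ceiling u)
    t≤deg : ∀ u → t u ≤ deg G u
    t≤deg u = proj₁ (proj₂ (ceiling u))
    α*deg≤t : ∀ u → α * ℕtoℚ (deg G u) ℚ.≤ ℕtoℚ (t u)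
    α*deg≤t u = proj₁ (proj₂ (proj₂ (ceiling u)))
    open Potential G t t≤deg (suc n !) 1+d∣[1+n]! using (q; q-spec)
    open Greedy G α t t≤deg α*deg≤t (suc n !) 1+d∣[1+n]! using (MD-weight-bound)
    scaledShare : Fin n → ℕ
    scaledShare u = t u ℕ.* q (deg G u)
    share≤ : ∀ u → ℕtoℚ (scaledShare u ℕ.* suc δ) ℚ.≤ (α * ℕtoℚ δ + 1ℚ) * ℕtoℚ (suc n !)
    share≤ u = threshold-share δ (deg G u) (t u) (q (deg G u)) α≤1 (δ≤deg u)
                 (proj₂ (proj₂ (proj₂ (ceiling u)))) (q-spec (Counting.countTrue≤n (Graph.adj G u)))

theorem1 : (α : ℚ) → (α>0 : 0ℚ < α) → α < 1ℚ →
    (n : ℕ) → 2 ≤ n → (G : Graph n) → Connected G →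
    (δ : ℕ) → IsMinDegree G δ →
    (m : ℕ) → IsMD G α m →
    (1 ≤ m) × (ℕtoℚ m Data.Rational.≤ (ℕtoℚ δ + (1/ α) {{>-nonZero α>0}}) * ((+ 1) / suc δ) * α * ℕtoℚ n)
theorem1 α α>0 α<1 n 2≤n G connected δ (δ≤deg , _) m isMD =
  MD-positive G α α>0 2≤n connected isMD , MD-upper G α α>0 α<1 δ≤deg isMD
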